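{- Let $G$ be a connected interval graph with interval representation $\{[\ell_v,r_v]: v\in V(G)\}$, and let $S\subseteq V(G)$ be a non-empty set inducing a connected subgraph. Set $L_G(S)=\{u\in V(G): r_u<\min_{s\in S}\ell_s\}$ and $R_G(S)=\{w\in V(G): \ell_w>\max_{s\in S}r_s\}$. (i) Any two vertices of $L_G(S)$ are equivalent with respect to $\approx_{G,S}$, and any two vertices of $R_G(S)$ are equivalent with respect to $\approx_{G,S}$. In particular, $\approx_{G,S}$ has at most two equivalence classes on $V(G)\setminus N_G[S]$. (ii) If there is a vertex $s\in S$ with $\deg_G(s)\ge\Delta(G)-1$, then each of $L_G(S)$ and $R_G(S)$ is an equivalence class of $\approx_{G,S}$; in particular $L_G(S)\neq R_G(S)$.
   Context: $\Delta(G)$ is the maximum degree and $N_G[S]=\bigcup_{s\in S}N_G[s]$. For $S\subseteq V(G)$, on $V(G)\setminus N_G[S]$ define $u\sim_G u'$ iff $N_G[u]\cap N_G[u']\neq\emptyset$, and let $\approx_{G,S}$ be the transitive closure of $\sim_G$ on $V(G)\setminus N_G[S]$.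
   Formalization: The interval endpoints $\ell_v$ and $r_v$ are rational rather than real. -}

module Defs where

open import Data.Nat using (ℕ; _⊔_)
open import Data.Fin using (Fin)
open import Data.Fin.Properties using (_≟_)
open import Data.Rational using (ℚ; _≤_; _<_; _≤?_)
open import Data.List using (List; length; filter; allFin; foldr; map)
open import Data.Product using (Σ; _×_; _,_; ∃)
open import Data.Sum using (_⊎_)
open import Relation.Nullary using (¬_; Dec; yes; no)
open import Relation.Nullary.Decidable using (_×-dec_; ¬?)
open import Relation.Binary.PropositionalEquality using (_≡_)
open import Relation.Binary.Construct.Closure.ReflexiveTransitive using (Star)
open import Relation.Binary.Construct.Closure.Transitive using (TransClosure)

record IntervalRep (n : ℕ) : Set where
  field
    ℓ     : Fin n → ℚ
    r     : Fin n → ℚ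
    ℓ≤r   : ∀ v → ℓ v ≤ r v

module IntervalGraph {n : ℕ} (I : IntervalRep n) where
  open IntervalRep I

  Adj : Fin n → Fin n → Set
  Adj u v = ¬ (u ≡ v) × (ℓ u ≤ r v × ℓ v ≤ r u)

  Adj? : ∀ u v → Dec (Adj u v)
  Adj? u v = ¬? (u ≟ v) ×-dec ((ℓ u ≤? r v) ×-dec (ℓ v ≤? r u))

  deg : Fin n → ℕ
  deg v = length (filter (λ u → Adj? u v) (allFin n))

  Δ : ℕ
  Δ = foldr _⊔_ 0 (map deg (allFin n))

  Connected : Set
  Connected = ∀ u v → Star Adj u v

  InducesConnected : (Fin n → Set) → Set
  InducesConnected S =
    ∀ u v → S u → S v → Star (λ a b → S a × S b × Adj a b) u v

  N[_] : Fin n → Fin n → Set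
  N[ u ] x = x ≡ u ⊎ Adj x u

  NS[_] : (Fin n → Set) → Fin n → Set
  NS[ S ] x = ∃ λ s → S s × N[ s ] x

  Outside : (Fin n → Set) → Fin n → Set
  Outside S x = ¬ NS[ S ] x

  _∼_ : Fin n → Fin n → Set
  u ∼ u' = ∃ λ x → N[ u ] x × N[ u' ] x

  _≈[_]_ : Fin n → (Fin n → Set) → Fin n → Set
  u ≈[ S ] u' = TransClosure (λ a b → Outside S a × Outside S b × a ∼ b) u u'

  LG : (Fin n → Set) → Fin n → Set
  LG S u = ∀ s → S s → r u < ℓ s

  RG : (Fin n → Set) → Fin n → Set
  RG S w = ∀ s → S s → r s < ℓ w

  IsClass : (Fin n → Set) → (Fin n → Set) → Set
  IsClass S C =
    (∃ λ u → C u) ×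
    (∀ u → C u → Outside S u) ×
    (∀ u x → C u → Outside S x → (x ≈[ S ] u → C x) × (C x → x ≈[ S ] u))

{-# OPTIONS --safe #-}
module Submission where

-- Since G[S] is connected, the intervals of S cover a contiguous stretch of the line, so a
-- vertex outside N[S] lies entirely to its left (L) or to its right (R).  Two vertices u, u'
-- of L are ≈-linked by following a G-path from u towards S: its vertices stay in L until the
-- first one whose interval reaches past r(u'), and that one meets u'.  For (ii), a common
-- neighbour x of some a ∈ L and b ∈ R has an interval containing that of s, so
-- N[s] ∪ {a, b} ⊆ N[x] and deg x ≥ deg s + 2 > Δ; hence no ∼-step crosses from L to R.

open import Defs
open import Data.Nat using (ℕ; _≤_; _∸_)
open import Data.Fin using (Fin)
open import Data.Product using (_×_; ∃)
open import Data.Sum using (_⊎_)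
open import Relation.Nullary using (¬_)

open import Level using (Level)
open import Data.Nat as ℕ using (suc; _<_; _+_)
import Data.Nat.Properties as ℕ
open import Data.Fin.Properties using (_≟_)
open import Data.Rational as ℚ using (ℚ)
import Data.Rational.Properties as ℚ
open import Data.List using (_∷_; length; filter; map; allFin)
open import Data.List.Properties using (filter-accept; filter-reject; foldr-preservesᵒ)
open import Data.List.Membership.Propositional using (_∈_)
open import Data.List.Membership.Propositional.Properties using (∈-filter⁺; ∈-filter⁻; ∈-allFin)
open import Data.List.Relation.Unary.All as All using (All; []; _∷_)
open import Data.List.Relation.Unary.Any as Any using (here; there)
open import Data.List.Relation.Unary.Any.Properties using (map⁺)
open import Data.List.Relation.Unary.Unique.Propositional using (Unique; _∷_)
open import Data.List.Relation.Unary.Unique.Propositional.Properties using (allFin⁺)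
open import Data.List.Relation.Binary.Sublist.Propositional using (⊆-refl) renaming (_⊆_ to _⊑_)
open import Data.List.Relation.Binary.Sublist.Propositional.Properties
  using (filter⁺; length-mono-≤; to-≋)
open import Data.List.Relation.Binary.Equality.Propositional using (≋⇒≡)
open import Data.Product using (_,_; proj₁; proj₂)
open import Data.Sum as Sum using (inj₁; inj₂)
open import Data.Empty using (⊥; ⊥-elim)
open import Function using (id; _∘_; case_of_)
open import Relation.Nullary using (yes; no; _⊎-dec_)
open import Relation.Unary using (Pred; Decidable; _⊆_)
open import Relation.Binary.Definitions using (DecidableEquality)
open import Relation.Binary.PropositionalEquality using (_≡_; _≢_; refl; sym; trans; cong; subst)
open import Relation.Binary.Construct.Closure.ReflexiveTransitive using (Star; ε; _◅_)
open import Relation.Binary.Construct.Closure.Transitive using ([_]; _∷_; symmetric)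

module _ {a p q : Level} {A : Set a} {P : Pred A p} {Q : Pred A q}
         (P? : Decidable P) (Q? : Decidable Q) (P⊆Q : P ⊆ Q) where

  filter-sublist : ∀ xs → filter P? xs ⊑ filter Q? xs
  filter-sublist xs = filter⁺ P? Q? (λ { refl → P⊆Q }) (⊆-refl {x = xs})

  length-filter-⊆ : ∀ xs → length (filter P? xs) ≤ length (filter Q? xs)
  length-filter-⊆ xs = length-mono-≤ (filter-sublist xs)

  -- A sublist of the same length is the whole list, so it would contain x.
  length-filter-⊂ : ∀ {x xs} → x ∈ xs → ¬ P x → Q x →
                    length (filter P? xs) < length (filter Q? xs)
  length-filter-⊂ {x} {xs} x∈xs ¬Px Qx = ℕ.≤∧≢⇒< (length-filter-⊆ xs) λ same-length →
    let P-filter≡Q-filter = ≋⇒≡ (to-≋ same-length (filter-sublist xs))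
        x∈P-filter = subst (x ∈_) (sym P-filter≡Q-filter) (∈-filter⁺ Q? x∈xs Qx)
    in ¬Px (proj₂ (∈-filter⁻ P? {xs = xs} x∈P-filter))

module _ {a p : Level} {A : Set a} (_≟ᴬ_ : DecidableEquality A)
         {P : Pred A p} (P? : Decidable P) where

  ⁅_⁆∪? : (x : A) → Decidable (λ y → y ≡ x ⊎ P y)
  ⁅ x ⁆∪? y = y ≟ᴬ x ⊎-dec P? y

  filter-∪-∉ : ∀ {x ys} → All (x ≢_) ys → filter ⁅ x ⁆∪? ys ≡ filter P? ys
  filter-∪-∉ [] = refl
  filter-∪-∉ {x} {y ∷ ys} (x≢y ∷ x∉ys) = case P? y of λ where
    (yes Py) → trans (filter-accept ⁅ x ⁆∪? (inj₂ Py))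
                     (trans (cong (y ∷_) (filter-∪-∉ x∉ys)) (sym (filter-accept P? Py)))
    (no ¬Py) → trans (filter-reject ⁅ x ⁆∪? Sum.[ (λ y≡x → x≢y (sym y≡x)) , ¬Py ])
                     (trans (filter-∪-∉ x∉ys) (sym (filter-reject P? ¬Py)))

  length-filter-insert : ∀ {x xs} → Unique xs → x ∈ xs → ¬ P x →
                         length (filter ⁅ x ⁆∪? xs) ≡ suc (length (filter P? xs))
  length-filter-insert {x} (x∉ys ∷ _) (here refl) ¬Px =
    trans (cong length (filter-accept ⁅ x ⁆∪? (inj₁ refl)))
          (cong suc (trans (cong length (filter-∪-∉ x∉ys))
                           (sym (cong length (filter-reject P? ¬Px)))))
  length-filter-insert {x} {y ∷ ys} (y∉ys ∷ ys-unique) (there x∈ys) ¬Px = case P? y of λ where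
    (yes Py) → trans (cong length (filter-accept ⁅ x ⁆∪? (inj₂ Py)))
                     (trans (cong suc (length-filter-insert ys-unique x∈ys ¬Px))
                            (sym (cong (suc ∘ length) (filter-accept P? Py))))
    (no ¬Py) → trans (cong length (filter-reject ⁅ x ⁆∪? Sum.[ All.lookup y∉ys x∈ys , ¬Py ]))
                     (trans (length-filter-insert ys-unique x∈ys ¬Px)
                            (sym (cong (suc ∘ length) (filter-reject P? ¬Py))))

<⇒≱ : ∀ {p q : ℚ} → p ℚ.< q → ¬ q ℚ.≤ p
<⇒≱ p<q q≤p = ℚ.<-irrefl refl (ℚ.<-≤-trans p<q q≤p)

module IntervalGraphProperties {n : ℕ} (I : IntervalRep n) where
  open IntervalRep I
  open IntervalGraph I

  private variable
    a b s t u v w x y z : Fin n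

  Overlap : Fin n → Fin n → Set
  Overlap u v = ℓ u ℚ.≤ r v × ℓ v ℚ.≤ r u

  overlap-refl : ∀ v → Overlap v v
  overlap-refl v = ℓ≤r v , ℓ≤r v

  overlap-sym : Overlap u v → Overlap v u
  overlap-sym (p , q) = q , p

  N⇒overlap : N[ v ] u → Overlap u v
  N⇒overlap {u = u} (inj₁ refl)     = overlap-refl u
  N⇒overlap         (inj₂ (_ , ov)) = ov

  overlap⇒N : Overlap u v → N[ v ] u
  overlap⇒N {u} {v} ov with u ≟ v
  ... | yes u≡v = inj₁ u≡v
  ... | no  u≢v = inj₂ (u≢v , ov)

  ∼-via : Overlap x u → Overlap x v → u ∼ v
  ∼-via {x} xu xv = x , overlap⇒N xu , overlap⇒N xv

  ∼-sym : u ∼ v → v ∼ u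
  ∼-sym (x , xu , xv) = x , xv , xu

  N-⊆ : ℓ x ℚ.≤ ℓ s → r s ℚ.≤ r x → N[ s ] ⊆ N[ x ]
  N-⊆ ℓx≤ℓs rs≤rx y∈N[s] with N⇒overlap y∈N[s]
  ... | ℓy≤rs , ℓs≤ry = overlap⇒N (ℚ.≤-trans ℓy≤rs rs≤rx , ℚ.≤-trans ℓx≤ℓs ℓs≤ry)

  ¬overlap⇒before⊎after : ¬ Overlap x y → r x ℚ.< ℓ y ⊎ r y ℚ.< ℓ x
  ¬overlap⇒before⊎after {x} {y} ¬ov with ℓ x ℚ.≤? r y
  ... | no  ℓx≰ry = inj₂ (ℚ.≰⇒> ℓx≰ry)
  ... | yes ℓx≤ry = inj₁ (ℚ.≰⇒> λ ℓy≤rx → ¬ov (ℓx≤ry , ℓy≤rx))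

  before-overlapping : ¬ Overlap x b → Overlap a b → r x ℚ.< ℓ a → r x ℚ.< ℓ b
  before-overlapping {x} ¬ov (ℓa≤rb , _) rx<ℓa = ℚ.≰⇒> λ ℓb≤rx →
    ¬ov (ℚ.<⇒≤ (ℚ.≤-<-trans (ℓ≤r x) (ℚ.<-≤-trans rx<ℓa ℓa≤rb)) , ℓb≤rx)

  after-overlapping : ¬ Overlap x b → Overlap a b → r a ℚ.< ℓ x → r b ℚ.< ℓ x
  after-overlapping {x} ¬ov (_ , ℓb≤ra) ra<ℓx = ℚ.≰⇒> λ ℓx≤rb →
    ¬ov (ℓx≤rb , ℚ.<⇒≤ (ℚ.≤-<-trans ℓb≤ra (ℚ.<-≤-trans ra<ℓx (ℓ≤r x))))

  N[_]? : ∀ v → Decidable N[ v ]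
  N[ v ]? = ⁅_⁆∪? _≟_ (λ u → Adj? u v) v

  ∣N[_]∣ : Fin n → ℕ
  ∣N[ v ]∣ = length (filter N[ v ]? (allFin n))

  ∣N[v]∣≡1+deg : ∀ v → ∣N[ v ]∣ ≡ suc (deg v)
  ∣N[v]∣≡1+deg v =
    length-filter-insert _≟_ (λ u → Adj? u v) (allFin⁺ n) (∈-allFin v) λ (v≢v , _) → v≢v refl

  deg-gap : N[ s ] ⊆ N[ x ] → N[ x ] a → ¬ N[ s ] a → N[ x ] b → ¬ N[ s ] b → a ≢ b →
            2 + deg s ≤ deg x
  deg-gap {s} {x} {a} {b} N[s]⊆N[x] a∈N[x] a∉N[s] b∈N[x] b∉N[s] a≢b = ℕ.s≤s⁻¹ (begin
    3 + deg s                ≡⟨ cong (2 +_) (∣N[v]∣≡1+deg s) ⟨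
    2 + ∣N[ s ]∣             ≤⟨ ℕ.s≤s (length-filter-⊂ N[ s ]? N[s]+a? inj₁ (∈-allFin a) a∉N[s] (inj₂ refl)) ⟩
    suc (count N[s]+a?)      ≤⟨ length-filter-⊂ N[s]+a? N[s]+a+b? inj₁ (∈-allFin b) b∉N[s]+a (inj₂ refl) ⟩
    count N[s]+a+b?          ≤⟨ length-filter-⊆ N[s]+a+b? N[ x ]? N[s]+a+b⊆N[x] (allFin n) ⟩
    ∣N[ x ]∣                 ≡⟨ ∣N[v]∣≡1+deg x ⟩
    suc (deg x)              ∎)
    where
    open ℕ.≤-Reasoning
    count : {P : Pred (Fin n) _} → Decidable P → ℕ
    count P? = length (filter P? (allFin n))
    N[s]+a? : Decidable (λ y → N[ s ] y ⊎ y ≡ a)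
    N[s]+a? y = N[ s ]? y ⊎-dec y ≟ a
    N[s]+a+b? : Decidable (λ y → (N[ s ] y ⊎ y ≡ a) ⊎ y ≡ b)
    N[s]+a+b? y = N[s]+a? y ⊎-dec y ≟ b
    b∉N[s]+a : ¬ (N[ s ] b ⊎ b ≡ a)
    b∉N[s]+a = Sum.[ b∉N[s] , (λ b≡a → a≢b (sym b≡a)) ]
    N[s]+a+b⊆N[x] : (λ y → (N[ s ] y ⊎ y ≡ a) ⊎ y ≡ b) ⊆ N[ x ]
    N[s]+a+b⊆N[x] (inj₁ (inj₁ y∈N[s])) = N[s]⊆N[x] y∈N[s]
    N[s]+a+b⊆N[x] (inj₁ (inj₂ refl))   = a∈N[x]
    N[s]+a+b⊆N[x] (inj₂ refl)          = b∈N[x]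

  deg≤Δ : ∀ v → deg v ≤ Δ
  deg≤Δ v = foldr-preservesᵒ {P = deg v ≤_}
    (λ d e → Sum.[ ℕ.m≤n⇒m≤n⊔o e , ℕ.m≤n⇒m≤o⊔n d ]) 0 (map deg (allFin n))
    (inj₂ (map⁺ (Any.map (λ { refl → ℕ.≤-refl }) (∈-allFin v))))

  module _ {S : Fin n → Set} where

    outside-intro : (∀ {s} → S s → ¬ Overlap x s) → Outside S x
    outside-intro no-overlap (_ , Ss , x∈N[s]) = no-overlap Ss (N⇒overlap x∈N[s])

    outside-elim : Outside S x → S s → ¬ Overlap x s
    outside-elim x-out Ss ov = x-out (_ , Ss , overlap⇒N ov)

    LG⇒Outside : LG S u → Outside S u
    LG⇒Outside Lu = outside-intro λ Ss (_ , ℓs≤ru) → <⇒≱ (Lu _ Ss) ℓs≤ru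

    RG⇒Outside : RG S w → Outside S w
    RG⇒Outside Rw = outside-intro λ Ss (ℓw≤rs , _) → <⇒≱ (Rw _ Ss) ℓw≤rs

    LG-RG-disjoint : S s → LG S u → RG S u → ⊥
    LG-RG-disjoint {s} {u} Ss Lu Ru =
      <⇒≱ (ℚ.<-trans (ℚ.<-≤-trans (Lu s Ss) (ℓ≤r s)) (Ru s Ss)) (ℓ≤r u)

    ≈-sym : u ≈[ S ] v → v ≈[ S ] u
    ≈-sym = symmetric _ λ (u-out , v-out , u∼v) → v-out , u-out , ∼-sym u∼v

    before-spreads : Outside S x → Star (λ a b → S a × S b × Adj a b) a b →
                     r x ℚ.< ℓ a → r x ℚ.< ℓ b
    before-spreads x-out ε = id
    before-spreads x-out ((_ , Sc , _ , ov) ◅ path) rx<ℓa =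
      before-spreads x-out path (before-overlapping (outside-elim x-out Sc) ov rx<ℓa)

    after-spreads : Outside S x → Star (λ a b → S a × S b × Adj a b) a b →
                    r a ℚ.< ℓ x → r b ℚ.< ℓ x
    after-spreads x-out ε = id
    after-spreads x-out ((_ , Sc , _ , ov) ◅ path) ra<ℓx =
      after-spreads x-out path (after-overlapping (outside-elim x-out Sc) ov ra<ℓx)

    Outside⇒LG⊎RG : S s → InducesConnected S → Outside S x → LG S x ⊎ RG S x
    Outside⇒LG⊎RG {s} Ss S-conn x-out with ¬overlap⇒before⊎after (outside-elim x-out Ss)
    ... | inj₁ rx<ℓs = inj₁ λ t St → before-spreads x-out (S-conn s t Ss St) rx<ℓs
    ... | inj₂ rs<ℓx = inj₂ λ t St → after-spreads x-out (S-conn s t Ss St) rs<ℓx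

    LG⇒r≤r : S s → LG S u → r u ℚ.≤ r s
    LG⇒r≤r {s} Ss Lu = ℚ.<⇒≤ (ℚ.<-≤-trans (Lu s Ss) (ℓ≤r s))

    RG⇒ℓ≤ℓ : S s → RG S u → ℓ s ℚ.≤ ℓ u
    RG⇒ℓ≤ℓ {s} Ss Ru = ℚ.<⇒≤ (ℚ.≤-<-trans (ℓ≤r s) (Ru s Ss))

    LG-below : LG S u → r v ℚ.≤ r u → LG S v
    LG-below Lu rv≤ru t St = ℚ.≤-<-trans rv≤ru (Lu t St)

    RG-above : RG S u → ℓ u ℚ.≤ ℓ v → RG S v
    RG-above Ru ℓu≤ℓv t St = ℚ.<-≤-trans (Ru t St) ℓu≤ℓv

    LG-path-≈ : LG S u → Star Adj v t → r v ℚ.≤ r u → r u ℚ.≤ r t → v ≈[ S ] u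
    LG-path-≈ {u} {v} Lu ε rv≤ru ru≤rv =
      [ LG⇒Outside (LG-below Lu rv≤ru) , LG⇒Outside Lu ,
        ∼-via (overlap-refl v) (ℚ.≤-trans (ℓ≤r v) rv≤ru , ℚ.≤-trans (ℓ≤r u) ru≤rv) ]
    LG-path-≈ {u} {v} Lu (_◅_ {j = w} (_ , ℓv≤rw , ℓw≤rv) path) rv≤ru ru≤rt with r w ℚ.≤? r u
    ... | yes rw≤ru = (LG⇒Outside (LG-below Lu rv≤ru) , LG⇒Outside (LG-below Lu rw≤ru) ,
                       ∼-via (ℓw≤rv , ℓv≤rw) (overlap-refl w))
                      ∷ LG-path-≈ Lu path rw≤ru ru≤rt
    ... | no  rw≰ru = [ LG⇒Outside (LG-below Lu rv≤ru) , LG⇒Outside Lu ,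
                        ∼-via (ℓw≤rv , ℓv≤rw)
                              (ℚ.≤-trans ℓw≤rv rv≤ru , ℚ.≤-trans (ℓ≤r u) (ℚ.<⇒≤ (ℚ.≰⇒> rw≰ru))) ]

    RG-path-≈ : RG S u → Star Adj v t → ℓ u ℚ.≤ ℓ v → ℓ t ℚ.≤ ℓ u → v ≈[ S ] u
    RG-path-≈ {u} {v} Ru ε ℓu≤ℓv ℓv≤ℓu =
      [ RG⇒Outside (RG-above Ru ℓu≤ℓv) , RG⇒Outside Ru ,
        ∼-via (overlap-refl v) (ℚ.≤-trans ℓv≤ℓu (ℓ≤r u) , ℚ.≤-trans ℓu≤ℓv (ℓ≤r v)) ]
    RG-path-≈ {u} {v} Ru (_◅_ {j = w} (_ , ℓv≤rw , ℓw≤rv) path) ℓu≤ℓv ℓt≤ℓu with ℓ u ℚ.≤? ℓ w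
    ... | yes ℓu≤ℓw = (RG⇒Outside (RG-above Ru ℓu≤ℓv) , RG⇒Outside (RG-above Ru ℓu≤ℓw) ,
                       ∼-via (ℓw≤rv , ℓv≤rw) (overlap-refl w))
                      ∷ RG-path-≈ Ru path ℓu≤ℓw ℓt≤ℓu
    ... | no  ℓu≰ℓw = [ RG⇒Outside (RG-above Ru ℓu≤ℓv) , RG⇒Outside Ru ,
                        ∼-via (ℓw≤rv , ℓv≤rw)
                              (ℚ.<⇒≤ (ℚ.<-≤-trans (ℚ.≰⇒> ℓu≰ℓw) (ℓ≤r u)) , ℚ.≤-trans ℓu≤ℓv ℓv≤rw) ]

  module _ (conn : Connected) {S : Fin n → Set} {s} (Ss : S s) where

    LG-≈-connected : LG S u → LG S v → u ≈[ S ] v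
    LG-≈-connected {u} {v} Lu Lv with ℚ.≤-total (r u) (r v)
    ... | inj₁ ru≤rv = LG-path-≈ Lv (conn u s) ru≤rv (LG⇒r≤r Ss Lv)
    ... | inj₂ rv≤ru = ≈-sym (LG-path-≈ Lu (conn v s) rv≤ru (LG⇒r≤r Ss Lu))

    RG-≈-connected : RG S u → RG S v → u ≈[ S ] v
    RG-≈-connected {u} {v} Ru Rv with ℚ.≤-total (ℓ u) (ℓ v)
    ... | inj₁ ℓu≤ℓv = ≈-sym (RG-path-≈ Ru (conn v s) ℓu≤ℓv (RG⇒ℓ≤ℓ Ss Ru))
    ... | inj₂ ℓv≤ℓu = RG-path-≈ Rv (conn u s) ℓv≤ℓu (RG⇒ℓ≤ℓ Ss Rv)

    module _ (S-conn : InducesConnected S) where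

      at-most-two-classes : Outside S x → Outside S y → Outside S z →
                            x ≈[ S ] y ⊎ y ≈[ S ] z ⊎ x ≈[ S ] z
      at-most-two-classes x-out y-out z-out
        with Outside⇒LG⊎RG Ss S-conn x-out | Outside⇒LG⊎RG Ss S-conn y-out
           | Outside⇒LG⊎RG Ss S-conn z-out
      ... | inj₁ Lx | inj₁ Ly | _       = inj₁ (LG-≈-connected Lx Ly)
      ... | inj₂ Rx | inj₂ Ry | _       = inj₁ (RG-≈-connected Rx Ry)
      ... | inj₁ _  | inj₂ Ry | inj₂ Rz = inj₂ (inj₁ (RG-≈-connected Ry Rz))
      ... | inj₂ _  | inj₁ Ly | inj₁ Lz = inj₂ (inj₁ (LG-≈-connected Ly Lz))
      ... | inj₁ Lx | inj₂ _  | inj₁ Lz = inj₂ (inj₂ (LG-≈-connected Lx Lz))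
      ... | inj₂ Rx | inj₁ _  | inj₂ Rz = inj₂ (inj₂ (RG-≈-connected Rx Rz))

      module _ (deg-s : Δ ∸ 1 ≤ deg s) where

        LG≁RG : LG S a → RG S b → ¬ a ∼ b
        LG≁RG {a} {b} La Rb (x , x∈N[a] , x∈N[b]) =
          ℕ.<⇒≱ deg-x-large (ℕ.≤-trans (deg≤Δ x) Δ≤1+deg-s)
          where
          Δ≤1+deg-s : Δ ≤ suc (deg s)
          Δ≤1+deg-s = ℕ.≤-trans (ℕ.m≤n+m∸n Δ 1) (ℕ.s≤s deg-s)
          xa : Overlap x a
          xa = N⇒overlap x∈N[a]
          xb : Overlap x b
          xb = N⇒overlap x∈N[b]
          ℓx≤ℓs : ℓ x ℚ.≤ ℓ s
          ℓx≤ℓs = ℚ.<⇒≤ (ℚ.≤-<-trans (proj₁ xa) (La s Ss))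
          rs≤rx : r s ℚ.≤ r x
          rs≤rx = ℚ.<⇒≤ (ℚ.<-≤-trans (Rb s Ss) (proj₂ xb))
          deg-x-large : 2 + deg s ≤ deg x
          deg-x-large = deg-gap (N-⊆ ℓx≤ℓs rs≤rx)
            (overlap⇒N (overlap-sym xa)) (λ a∈N[s] → LG⇒Outside La (s , Ss , a∈N[s]))
            (overlap⇒N (overlap-sym xb)) (λ b∈N[s] → RG⇒Outside Rb (s , Ss , b∈N[s]))
            (λ { refl → LG-RG-disjoint Ss La Rb })

        ∼-preserves-LG : LG S a → Outside S b → a ∼ b → LG S b
        ∼-preserves-LG La b-out a∼b =
          Sum.[ id , (λ Rb → ⊥-elim (LG≁RG La Rb a∼b)) ] (Outside⇒LG⊎RG Ss S-conn b-out)

        ≈-preserves-LG : a ≈[ S ] b → LG S a → LG S b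
        ≈-preserves-LG [ _ , b-out , a∼b ]         La = ∼-preserves-LG La b-out a∼b
        ≈-preserves-LG ((_ , c-out , a∼c) ∷ c≈b) La = ≈-preserves-LG c≈b (∼-preserves-LG La c-out a∼c)

        LG≉RG : LG S u → RG S w → ¬ u ≈[ S ] w
        LG≉RG Lu Rw u≈w = LG-RG-disjoint Ss (≈-preserves-LG u≈w Lu) Rw

        LG-isClass : ∃ (LG S) → IsClass S (LG S)
        LG-isClass L-inhabited = L-inhabited , (λ _ → LG⇒Outside) , λ u x Lu _ →
          (λ x≈u → ≈-preserves-LG (≈-sym x≈u) Lu) , (λ Lx → LG-≈-connected Lx Lu)

        RG-isClass : ∃ (RG S) → IsClass S (RG S)
        RG-isClass R-inhabited = R-inhabited , (λ _ → RG⇒Outside) , λ u x Ru x-out →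
          (λ x≈u → Sum.[ (λ Lx → ⊥-elim (LG≉RG Lx Ru x≈u)) , id ] (Outside⇒LG⊎RG Ss S-conn x-out)) ,
          (λ Rx → RG-≈-connected Rx Ru)

lemma14 : (n : ℕ) (I : IntervalRep n) → let open IntervalGraph I in
    Connected → (S : Fin n → Set) → (∃ λ s → S s) → InducesConnected S →
    -- (i)
    ((∀ u u' → LG S u → LG S u' → u ≈[ S ] u') ×
     (∀ w w' → RG S w → RG S w' → w ≈[ S ] w') ×
     (∀ x y z → Outside S x → Outside S y → Outside S z →
        x ≈[ S ] y ⊎ y ≈[ S ] z ⊎ x ≈[ S ] z))
    ×
    -- (ii)
    ((∃ λ s → S s × Δ ∸ 1 ≤ deg s) →
      ((∃ λ u → LG S u) → IsClass S (LG S)) ×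
      ((∃ λ w → RG S w) → IsClass S (RG S)) ×
      (∀ u w → LG S u → RG S w → ¬ (u ≈[ S ] w)))
lemma14 n I conn S (s₀ , Ss₀) S-conn =
  ( (λ _ _ → LG-≈-connected conn Ss₀)
  , (λ _ _ → RG-≈-connected conn Ss₀)
  , (λ _ _ _ → at-most-two-classes conn Ss₀ S-conn) )
  , λ (s , Ss , deg-s) → LG-isClass conn Ss S-conn deg-s
                       , RG-isClass conn Ss S-conn deg-s
                       , (λ _ _ → LG≉RG conn Ss S-conn deg-s)
  where open IntervalGraphProperties I
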